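{- Let $n\ge 1$, let $A\subseteq\{1,\dots,n\}$ be nonempty, and let $\mathbf p$ be any position of $SN(n,A)$ with $o$ stacks of odd height. (1) If $o=0$, then $\mathbf p$ is a P-position. (2) If $o\in A$, then $\mathbf p$ is an N-position.
   Context: The game $SN(n,A)$ is played on $n$ stacks of tokens; a position is $\mathbf p=(p_1,\dots,p_n)$ of nonnegative integers. A move consists of choosing some $\ell\in A$ and $\ell$ distinct stacks, each of height at least $1$, and removing exactly one token from each. Players alternate; a player unable to move loses (normal play). A P-position is one from which the player to move loses under optimal play; an N-position is one from which the player to move wins. -}

module Defs where

open import Data.Nat using (ℕ; zero; suc; _∸_; _≤_; _+_)
open import Data.Nat.Properties using (_≟_)
open import Data.Bool using (Bool; true; false; if_then_else_)
open import Data.Fin using (Fin)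
open import Data.Fin.Subset using (Subset; _∈_; _∉_; ∣_∣)
open import Data.Vec.Functional using (Vector)
open import Data.Product using (Σ; _×_; ∃)
open import Data.Nat.Base using (_%_)
open import Data.List using (List; length; filter)
open import Data.List.Base using (allFin)
open import Relation.Binary.PropositionalEquality using (_≡_)

Position : ℕ → Set
Position n = Vector ℕ n

oddCount : ∀ {n} → Position n → ℕ
oddCount {n} p = length (filter (λ i → (p i % 2) ≟ 1) (allFin n))

record Move {n : ℕ} (A : ℕ → Set) (p q : Position n) : Set where
  field
    S        : Subset n
    sizeInA  : A ∣ S ∣
    nonempty : ∀ i → i ∈ S → 1 ≤ p i
    chosen   : ∀ i → i ∈ S → q i ≡ p i ∸ 1
    others   : ∀ i → i ∉ S → q i ≡ p i

-- Normal-play outcome classes (well-founded since every move lowers the total).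
mutual
  data IsP {n : ℕ} (A : ℕ → Set) (p : Position n) : Set where
    allMovesToN : (∀ q → Move A p q → IsN A q) → IsP A p

  data IsN {n : ℕ} (A : ℕ → Set) (p : Position n) : Set where
    moveToP : (q : Position n) → Move A p q → IsP A q → IsN A p

-- If all stacks are even, any move with chosen set S leaves exactly the stacks
-- of S odd, so the opponent faces o = |S| ∈ A; whenever o ∈ A, removing one token from
-- each odd stack is a legal move back to an all-even position.  Since every move lowers
-- the total number of tokens, well-founded induction on it makes all-even positions P,
-- and hence positions with o ∈ A N.
module Submission where

open import Defs
open import Data.Nat using (ℕ; _≤_)
open import Data.Product using (_×_; ∃)
open import Relation.Binary.PropositionalEquality using (_≡_)

open import Data.Bool using (Bool; true; false; not; if_then_else_)
open import Data.Bool.Properties using (not-involutive)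
open import Data.Fin using (Fin; zero; suc)
open import Data.Fin.Subset using (Subset; Nonempty; _∈_; _∉_; ∣_∣)
open import Data.Fin.Subset.Properties using (_∈?_; nonempty?; Empty-unique; ∣⊥∣≡0; x∈p⇒∣p-x∣<∣p∣)
open import Data.List as List using (length; filter)
open import Data.Nat using (zero; suc; _+_; _<_; _∸_; _%_; z≤n; s≤s; z<s)
open import Data.Nat.Induction using (<-wellFounded)
open import Data.Nat.Properties using (_≟_; ≤-reflexive; +-mono-≤; +-mono-<-≤; +-mono-≤-<; <-trans; m∸n≤m; ∸-monoʳ-<; m<n⇒n≢0)
open import Data.Product using (_,_; proj₁)
open import Data.Vec using (lookup; tabulate)
open import Data.Vec.Properties using ([]=⇒lookup; lookup⇒[]=; lookup∘tabulate; tabulate∘lookup; tabulate-cong)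
open import Data.Vec.Functional using (foldr)
open import Function using (_∘_)
open import Induction.WellFounded using (Acc; acc)
open import Relation.Nullary using (Dec; yes; no; does; contradiction)
open import Relation.Binary.PropositionalEquality using (refl; sym; trans; cong; subst)

-- The same test as in oddCount, so that oddCount≡∣oddSet∣ is a pure counting fact.
odd : ℕ → Bool
odd x = does (x % 2 ≟ 1)

odd-suc : ∀ (x : ℕ) → odd (suc x) ≡ not (odd x)
odd-suc zero          = refl
odd-suc (suc zero)    = refl
odd-suc (suc (suc x)) = odd-suc x

odd-∸1 : ∀ (x : ℕ) → 1 ≤ x → odd (x ∸ 1) ≡ not (odd x)
odd-∸1 (suc x) _ = trans (sym (not-involutive (odd x))) (cong not (sym (odd-suc x)))

odd⇒1≤ : ∀ (x : ℕ) → odd x ≡ true → 1 ≤ x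
odd⇒1≤ (suc x) _ = s≤s z≤n

0<∣p∣⇒Nonempty : ∀ {n} (S : Subset n) → 0 < ∣ S ∣ → Nonempty S
0<∣p∣⇒Nonempty {n} S 0<∣S∣ with nonempty? S
... | yes nonempty = nonempty
... | no empty     = contradiction (trans (cong ∣_∣ (Empty-unique empty)) (∣⊥∣≡0 n)) (m<n⇒n≢0 0<∣S∣)

length-filter-tabulate : ∀ {k} {X : Set} {P : X → Set} (P? : ∀ x → Dec (P x)) (g : Fin k → X) →
  length (filter P? (List.tabulate g)) ≡ ∣ tabulate (λ i → does (P? (g i))) ∣
length-filter-tabulate {zero}  P? g = refl
length-filter-tabulate {suc k} P? g with P? (g zero)
... | yes _ = cong suc (length-filter-tabulate P? (g ∘ suc))
... | no _  = length-filter-tabulate P? (g ∘ suc)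

module _ {n : ℕ} where

  oddSet : Position n → Subset n
  oddSet p = tabulate (odd ∘ p)

  oddCount≡∣oddSet∣ : ∀ p → oddCount p ≡ ∣ oddSet p ∣
  oddCount≡∣oddSet∣ p = length-filter-tabulate (λ i → p i % 2 ≟ 1) (λ i → i)

  ∈oddSet⇒odd : ∀ {p i} → i ∈ oddSet p → odd (p i) ≡ true
  ∈oddSet⇒odd {p} {i} i∈ = trans (sym (lookup∘tabulate (odd ∘ p) i)) ([]=⇒lookup i∈)

  odd⇒∈oddSet : ∀ p {i} → odd (p i) ≡ true → i ∈ oddSet p
  odd⇒∈oddSet p {i} odd[pi] =
    lookup⇒[]= i (oddSet p) (trans (lookup∘tabulate (odd ∘ p) i) odd[pi])

  AllEven : Position n → Set
  AllEven p = ∀ i → odd (p i) ≡ false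

  oddCount≡0⇒AllEven : ∀ {p} → oddCount p ≡ 0 → AllEven p
  oddCount≡0⇒AllEven {p} oddCount≡0 i with odd (p i) in odd[pi]
  ... | false = refl
  ... | true  = contradiction (trans (sym (oddCount≡∣oddSet∣ p)) oddCount≡0)
                              (m<n⇒n≢0 (x∈p⇒∣p-x∣<∣p∣ (odd⇒∈oddSet p odd[pi])))

  roundToEven : Position n → Position n
  roundToEven p i = if odd (p i) then p i ∸ 1 else p i

  roundToEven-AllEven : ∀ p → AllEven (roundToEven p)
  roundToEven-AllEven p i with odd (p i) in odd[pi]
  ... | false = odd[pi]
  ... | true  = trans (odd-∸1 (p i) (odd⇒1≤ (p i) odd[pi])) (cong not odd[pi])

total : ∀ {n} → Position n → ℕ
total = foldr _+_ 0

total-mono-≤ : ∀ {n} {p q : Position n} → (∀ i → q i ≤ p i) → total q ≤ total p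
total-mono-≤ {zero}  _   = z≤n
total-mono-≤ {suc n} q≤p = +-mono-≤ (q≤p zero) (total-mono-≤ (q≤p ∘ suc))

total-mono-< : ∀ {n} {p q : Position n} → (∀ i → q i ≤ p i) → ∀ j → q j < p j → total q < total p
total-mono-< q≤p zero    q<p = +-mono-<-≤ q<p (total-mono-≤ (q≤p ∘ suc))
total-mono-< q≤p (suc j) q<p = +-mono-≤-< (q≤p zero) (total-mono-< (q≤p ∘ suc) j q<p)

module _ {n : ℕ} {A : ℕ → Set} where

  Move⇒total< : (∀ l → A l → 1 ≤ l) → ∀ {p q : Position n} → Move A p q → total q < total p
  Move⇒total< A⁺ {p} {q} m with 0<∣p∣⇒Nonempty (Move.S m) (A⁺ _ (Move.sizeInA m))
  ... | j , j∈S =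
    total-mono-< q≤p j (subst (_< p j) (sym (chosen j j∈S)) (∸-monoʳ-< z<s (nonempty j j∈S)))
    where
      open Move m
      q≤p : ∀ i → q i ≤ p i
      q≤p i with i ∈? S
      ... | yes i∈S = subst (_≤ p i) (sym (chosen i i∈S)) (m∸n≤m (p i) 1)
      ... | no  i∉S = ≤-reflexive (others i i∉S)

  roundToEven-Move : ∀ {p : Position n} → A (oddCount p) → Move A p (roundToEven p)
  roundToEven-Move {p} a = record
    { S        = oddSet p
    ; sizeInA  = subst A (oddCount≡∣oddSet∣ p) a
    ; nonempty = λ i i∈ → odd⇒1≤ (p i) (∈oddSet⇒odd {p = p} i∈)
    ; chosen   = λ i i∈ → cong (λ b → if b then p i ∸ 1 else p i) (∈oddSet⇒odd {p = p} i∈)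
    ; others   = unchanged
    }
    where
      unchanged : ∀ i → i ∉ oddSet p → roundToEven p i ≡ p i
      unchanged i i∉ with odd (p i) in odd[pi]
      ... | false = refl
      ... | true  = contradiction (odd⇒∈oddSet p odd[pi]) i∉

  oddSet-Move-from-AllEven : ∀ {p q : Position n} → AllEven p → (m : Move A p q) →
                             oddSet q ≡ Move.S m
  oddSet-Move-from-AllEven {p} {q} even m = trans (tabulate-cong parity) (tabulate∘lookup S)
    where
      open Move m
      parity : ∀ i → odd (q i) ≡ lookup S i
      parity i with lookup S i in S[i]
      ... | true  = let i∈S = lookup⇒[]= i S S[i] in
                    trans (cong odd (chosen i i∈S))
                          (trans (odd-∸1 (p i) (nonempty i i∈S)) (cong not (even i)))
      ... | false = trans (cong odd (others i λ i∈S → contradiction (trans (sym ([]=⇒lookup i∈S)) S[i]) λ ()))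
                          (even i)

  Move-from-AllEven⇒oddCount∈A : ∀ {p q : Position n} → AllEven p → Move A p q → A (oddCount q)
  Move-from-AllEven⇒oddCount∈A {q = q} even m =
    subst A (sym (trans (oddCount≡∣oddSet∣ q) (cong ∣_∣ (oddSet-Move-from-AllEven even m)))) (Move.sizeInA m)

  module _ (A⁺ : ∀ l → A l → 1 ≤ l) where

    AllEven⇒IsP : ∀ {p : Position n} → Acc _<_ (total p) → AllEven p → IsP A p
    AllEven⇒IsP (acc rec) even = allMovesToN λ q m →
      let back = roundToEven-Move (Move-from-AllEven⇒oddCount∈A even m)
      in moveToP _ back (AllEven⇒IsP (rec (<-trans (Move⇒total< A⁺ back) (Move⇒total< A⁺ m)))
                                     (roundToEven-AllEven q))

    oddCount∈A⇒IsN : ∀ {p : Position n} → A (oddCount p) → IsN A p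
    oddCount∈A⇒IsN {p} a =
      moveToP _ (roundToEven-Move a) (AllEven⇒IsP (<-wellFounded _) (roundToEven-AllEven p))

theorem5 : (n : ℕ) → 1 ≤ n → (A : ℕ → Set) → (∀ l → A l → 1 ≤ l × l ≤ n) → ∃ A →
    (p : Position n) →
      (oddCount p ≡ 0 → IsP A p) × (A (oddCount p) → IsN A p)
theorem5 n _ A bounds _ p =
    (λ oddCount≡0 → AllEven⇒IsP A⁺ (<-wellFounded _) (oddCount≡0⇒AllEven {p = p} oddCount≡0))
  , oddCount∈A⇒IsN A⁺
  where
    A⁺ : ∀ l → A l → 1 ≤ l
    A⁺ l a = proj₁ (bounds l a)
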